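{- Any streaming certification scheme for $\mathrm{MaxClique}_{\leq 3}$ whose verifier uses $m$ bits of memory and whose certificates have $c$ bits satisfies $c+m=\Omega(n^2)$ on $n$-node graphs.
   Context: $\mathrm{MaxClique}_{\leq 3}$ is the decision problem (with fixed threshold $3$) taking as input a graph $G$ and asking whether the maximum clique of $G$ has size at most $3$. The $n$-node input graph on $[n]$ is given as a stream of edges in an arbitrary, possibly adversarial, order. A streaming certification scheme for a decision problem $P$ consists of a prover (a computationally unlimited function producing a certificate in $\{0,1\}^*$ depending only on the input graph, not on the edge order) and a verifier (a deterministic streaming algorithm with read-only access to the certificate that processes the stream and outputs accept or reject). Completeness: if $G$ satisfies $P$, some certificate makes the verifier accept for every edge order. Soundness: if $G$ does not satisfy $P$, the verifier rejects for every certificate and every edge order. $c$ is the certificate length and $m$ the verifier's memory excluding the certificate, as worst-case functions of $n$. -}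

module Defs where

open import Data.Nat using (ℕ; _≤_; _+_; _*_)
open import Data.Bool using (Bool; true; false)
open import Data.Fin using (Fin) renaming (_<_ to _<ᶠ_)
open import Data.Product using (Σ; _×_; _,_; proj₁; proj₂; ∃)
open import Data.Sum using (_⊎_)
open import Data.List using (List; foldl; length)
open import Data.List.Relation.Unary.Unique.Propositional using (Unique)
open import Data.List.Membership.Propositional using (_∈_)
open import Relation.Binary.PropositionalEquality using (_≡_)
open import Data.Vec using (Vec)
open import Data.Empty using (⊥)

-- An (undirected) edge of the complete graph on [n] = Fin n:
-- an unordered pair {u,v}, represented canonically as (u , v) with u < v.
Edge : ℕ → Set
Edge n = Σ (Fin n × Fin n) (λ p → proj₁ p <ᶠ proj₂ p)

Graph : ℕ → Set
Graph n = Edge n → Bool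

Adj : {n : ℕ} → Graph n → Fin n → Fin n → Set
Adj G u v = Σ (u <ᶠ v) (λ h → G ((u , v) , h) ≡ true)
          ⊎ Σ (v <ᶠ u) (λ h → G ((v , u) , h) ≡ true)

IsClique : {n : ℕ} → Graph n → List (Fin n) → Set
IsClique G vs = Unique vs × (∀ u v → u ∈ vs → v ∈ vs → u ≡ v ⊎ Adj G u v)

MaxClique≤3 : {n : ℕ} → Graph n → Set
MaxClique≤3 G = ∀ vs → IsClique G vs → length vs ≤ 3

IsEdgeOrder : {n : ℕ} → Graph n → List (Edge n) → Set
IsEdgeOrder G es = Unique es × (∀ e → (e ∈ es → G e ≡ true) × (G e ≡ true → e ∈ es))

Cert : Set
Cert = List Bool

record Scheme (n c m : ℕ) : Set where
  field
    prover    : Graph n → Cert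
    proverLen : ∀ G → length (prover G) ≤ c
    init      : Cert → Vec Bool m
    step      : Cert → Vec Bool m → Edge n → Vec Bool m
    out       : Cert → Vec Bool m → Bool

  run : Cert → List (Edge n) → Bool
  run w es = out w (foldl (step w) (init w) es)

Correct : {n c m : ℕ} → (P : Graph n → Set) → Scheme n c m → Set
Correct {n} P S =
    (∀ (G : Graph n) → P G → ∀ es → IsEdgeOrder G es → Scheme.run S (Scheme.prover S G) es ≡ true)
  × (∀ (G : Graph n) → (P G → ⊥) → ∀ (w : Cert) es → IsEdgeOrder G es → Scheme.run S w es ≡ false)

-- Fix k with n ≈ 3k. A k × k Boolean matrix M gives the K4-free graph G_M: an apex
-- joined to everything, over the triangle-free graph on U ∪ V ∪ W with U_i ~ V_j iff
-- M i j, U_i ~ W_j iff ¬ M i j, and V_j ~ W_j. Stream G_M with its U–V edges first.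
-- If M x i j = true and M y i j = false, then streaming the U–V edges of G_x followed
-- by the other edges of G_y streams a graph containing the K4 {apex, U_i, V_j, W_j},
-- so the certificate and the memory content after the U–V edges must already tell
-- G_x and G_y apart. This injects the 2^(k²) matrices into (c + 1 + m)-bit strings.

module Submission where

open import Defs
open import Data.Nat using (ℕ; zero; suc; _≤_; _+_; _*_; _^_; z≤n; s≤s; s≤s⁻¹)
import Data.Nat.Properties as ℕ
open import Data.Nat.DivMod using (_/_; _%_; m≡m%n+[m/n]*n; m%n<n)
open import Data.Nat.Tactic.RingSolver using (solve-∀)
open import Data.Bool using (Bool; true; false; T; not; _∧_; if_then_else_)
open import Data.Bool.Properties using (T-≡; T-∧)
open import Data.Fin using (Fin; zero; suc; _↑ˡ_; _↑ʳ_; splitAt; combine; remQuot) renaming (_<_ to _<ᶠ_)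
open import Data.Fin.Properties
  using (<-cmp; <-irrelevant; splitAt-↑ˡ; splitAt-↑ʳ; remQuot-combine; combine-remQuot; injective⇒≤; 2↔Bool)
  renaming (_<?_ to _<ᶠ?_; _≟_ to _≟ᶠ_)
open import Data.Maybe using (Maybe; just; nothing)
open import Data.Product using (Σ; ∃₂; _×_; _,_; proj₁; proj₂)
open import Data.Sum using (_⊎_; inj₁; inj₂; [_,_]′)
open import Data.Empty using (⊥; ⊥-elim)
open import Data.List using (List; []; _∷_; _++_; length; foldl; filterᵇ; allFin; cartesianProduct)
open import Data.List.Properties using (foldl-++; filter-≐)
open import Data.List.Membership.Propositional using (_∈_)
open import Data.List.Membership.Propositional.Properties
  using (∈-filter⁺; ∈-filter⁻; ∈-++⁺ˡ; ∈-++⁺ʳ; ∈-++⁻; ∈-allFin; ∈-cartesianProduct⁺)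
open import Data.List.Relation.Unary.All as All using ([]; _∷_)
open import Data.List.Relation.Unary.AllPairs as AllPairs using (AllPairs; []; _∷_)
import Data.List.Relation.Unary.AllPairs.Properties as AllPairs
open import Data.List.Relation.Unary.Any using (here; there)
open import Data.List.Relation.Unary.Unique.Propositional using (Unique)
open import Data.List.Relation.Unary.Unique.Propositional.Properties
  using (filter⁺; ++⁺; cartesianProduct⁺; allFin⁺)
open import Data.Vec as Vec using (Vec; []; _∷_; lookup; replicate; tabulate)
open import Data.Vec.Properties using (∷-injective; ++-injective; tabulate∘lookup; tabulate-cong)
open import Function using (_∘_; Injective)
open import Function.Bundles using (Inverse; Equivalence)
open import Relation.Binary.Definitions using (tri<; tri≈; tri>)
open import Relation.Binary.PropositionalEquality
open import Relation.Nullary using (¬_; yes; no; contradiction)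
open import Relation.Nullary.Decidable using (T?; ⌊_⌋; from-no; fromWitness)
open import Relation.Unary using (Decidable; Irrelevant)

IsK4 : {A : Set} → (A → A → Set) → A → A → A → A → Set
IsK4 _~_ a b c d = AllPairs _~_ (a ∷ b ∷ c ∷ d ∷ [])

AllPairs-lookup : {A : Set} {_~_ : A → A → Set} {x y : A} {xs : List A} →
                  (∀ {a b} → a ~ b → b ~ a) → AllPairs _~_ xs → x ∈ xs → y ∈ xs → x ≡ y ⊎ x ~ y
AllPairs-lookup sym (_ ∷ _)       (here refl) (here refl) = inj₁ refl
AllPairs-lookup sym (x~xs ∷ _)    (here refl) (there y∈) = inj₂ (All.lookup x~xs y∈)
AllPairs-lookup sym (y~xs ∷ _)    (there x∈) (here refl) = inj₂ (sym (All.lookup y~xs x∈))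
AllPairs-lookup sym (_ ∷ pairs)   (there x∈) (there y∈) = AllPairs-lookup sym pairs x∈ y∈

module _ {n : ℕ} {G : Graph n} where

  Adj-sym : ∀ {u v} → Adj G u v → Adj G v u
  Adj-sym (inj₁ uv) = inj₂ uv
  Adj-sym (inj₂ vu) = inj₁ vu

  Adj⇒≢ : ∀ {u v} → Adj G u v → u ≢ v
  Adj⇒≢ (inj₁ (u<u , _)) refl = ℕ.<-irrefl refl u<u
  Adj⇒≢ (inj₂ (u<u , _)) refl = ℕ.<-irrefl refl u<u

  clique⇒AllPairs : ∀ {vs} → IsClique G vs → AllPairs (Adj G) vs
  clique⇒AllPairs {[]}     _ = []
  clique⇒AllPairs {v ∷ vs} (v∉vs ∷ distinct , adjacent) =
    All.tabulate (λ {u} u∈ → adjacentTo u∈ (All.lookup v∉vs u∈))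
      ∷ clique⇒AllPairs (distinct , λ a b a∈ b∈ → adjacent a b (there a∈) (there b∈))
    where
    adjacentTo : ∀ {u} → u ∈ vs → v ≢ u → Adj G v u
    adjacentTo u∈ v≢u with adjacent v _ (here refl) (there u∈)
    ... | inj₁ v≡u = contradiction v≡u v≢u
    ... | inj₂ vu  = vu

  K4⇒¬MaxClique≤3 : ∀ {a b c d} → IsK4 (Adj G) a b c d → ¬ MaxClique≤3 G
  K4⇒¬MaxClique≤3 k4 maxClique =
    ℕ.1+n≰n (maxClique _ (AllPairs.map Adj⇒≢ k4 , λ _ _ → AllPairs-lookup Adj-sym k4))

  noK4⇒MaxClique≤3 : (∀ {a b c d} → ¬ IsK4 (Adj G) a b c d) → MaxClique≤3 G
  noK4⇒MaxClique≤3 noK4 []                  _ = z≤n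
  noK4⇒MaxClique≤3 noK4 (_ ∷ [])            _ = s≤s z≤n
  noK4⇒MaxClique≤3 noK4 (_ ∷ _ ∷ [])        _ = s≤s (s≤s z≤n)
  noK4⇒MaxClique≤3 noK4 (_ ∷ _ ∷ _ ∷ [])    _ = s≤s (s≤s (s≤s z≤n))
  noK4⇒MaxClique≤3 noK4 (_ ∷ _ ∷ _ ∷ _ ∷ _) clique = ⊥-elim (noK4 (AllPairs.take⁺ 4 (clique⇒AllPairs clique)))

Related : {L : Set} → (L → L → Bool) → L → L → Set
Related R a b = T (R a b)

SymmetricRel : {L : Set} → (L → L → Bool) → Set
SymmetricRel R = ∀ a b → T (R a b) → T (R b a)

IrreflexiveRel : {L : Set} → (L → L → Bool) → Set
IrreflexiveRel R = ∀ a → ¬ T (R a a)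

TriangleFree : {L : Set} → (L → L → Bool) → Set
TriangleFree R = ∀ a b c → T (R a b) → T (R a c) → T (R b c) → ⊥

labelGraph : {n : ℕ} {L : Set} → (L → L → Bool) → (Fin n → L) → Graph n
labelGraph R ℓ ((u , v) , _) = R (ℓ u) (ℓ v)

module _ {n : ℕ} {L : Set} {R : L → L → Bool} {ℓ : Fin n → L} where

  Adj⇒Related : SymmetricRel R → ∀ {u v} → Adj (labelGraph R ℓ) u v → T (R (ℓ u) (ℓ v))
  Adj⇒Related sym         (inj₁ (_ , uv)) = Equivalence.from T-≡ uv
  Adj⇒Related sym {u} {v} (inj₂ (_ , vu)) = sym (ℓ v) (ℓ u) (Equivalence.from T-≡ vu)

  Related⇒Adj : IrreflexiveRel R → ∀ {u v} → T (R (ℓ u) (ℓ v)) → T (R (ℓ v) (ℓ u)) → Adj (labelGraph R ℓ) u v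
  Related⇒Adj irrefl {u} {v} uv vu with <-cmp u v
  ... | tri< u<v _ _ = inj₁ (u<v , Equivalence.to T-≡ uv)
  ... | tri≈ _ refl _ = ⊥-elim (irrefl (ℓ u) uv)
  ... | tri> _ _ v<u = inj₂ (v<u , Equivalence.to T-≡ vu)

  labelGraph-MaxClique≤3 : SymmetricRel R → (∀ {a b c d} → ¬ IsK4 (Related R) a b c d) →
                           MaxClique≤3 (labelGraph R ℓ)
  labelGraph-MaxClique≤3 sym noK4 =
    noK4⇒MaxClique≤3 (λ k4 → noK4 (AllPairs.map⁺ (AllPairs.map (Adj⇒Related sym) k4)))

cone : {L : Set} → (L → L → Bool) → Maybe L → Maybe L → Bool
cone R nothing  nothing  = false
cone R nothing  (just _) = true
cone R (just _) nothing  = true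
cone R (just a) (just b) = R a b

module _ {L : Set} {R : L → L → Bool} where

  cone-sym : SymmetricRel R → SymmetricRel (cone R)
  cone-sym sym nothing  (just _) _  = _
  cone-sym sym (just _) nothing  _  = _
  cone-sym sym (just a) (just b) ab = sym a b ab

  cone-irrefl : IrreflexiveRel R → IrreflexiveRel (cone R)
  cone-irrefl irrefl nothing  ()
  cone-irrefl irrefl (just a) = irrefl a

  -- At most one label of a K4 is the apex, and the other three form a triangle of R.
  cone-K4-free : TriangleFree R → ∀ {a b c d} → ¬ IsK4 (Related (cone R)) a b c d
  cone-K4-free tf {just a}  {just b}  {just c}  {_}       ((ab ∷ ac ∷ _) ∷ (bc ∷ _) ∷ _)          = tf a b c ab ac bc
  cone-K4-free tf {just a}  {just b}  {nothing} {just d}  ((ab ∷ _ ∷ ad ∷ []) ∷ (_ ∷ bd ∷ []) ∷ _) = tf a b d ab ad bd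
  cone-K4-free tf {just a}  {nothing} {just c}  {just d}  ((_ ∷ ac ∷ ad ∷ []) ∷ _ ∷ (cd ∷ []) ∷ _) = tf a c d ac ad cd
  cone-K4-free tf {nothing} {just b}  {just c}  {just d}  (_ ∷ (bc ∷ bd ∷ []) ∷ (cd ∷ []) ∷ _)     = tf b c d bc bd cd
  cone-K4-free tf {nothing} {nothing}                     ((() ∷ _) ∷ _)
  cone-K4-free tf {nothing} {just _}  {nothing}           ((_ ∷ () ∷ _) ∷ _)
  cone-K4-free tf {nothing} {just _}  {just _}  {nothing} ((_ ∷ _ ∷ () ∷ _) ∷ _)
  cone-K4-free tf {just _}  {nothing} {nothing}           (_ ∷ (() ∷ _) ∷ _)
  cone-K4-free tf {just _}  {nothing} {just _}  {nothing} (_ ∷ (_ ∷ () ∷ _) ∷ _)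
  cone-K4-free tf {just _}  {just _}  {nothing} {nothing} (_ ∷ _ ∷ (() ∷ _) ∷ _)

ifThenElse-irrefl : {L : Set} {s R R′ : L → L → Bool} → IrreflexiveRel R → IrreflexiveRel R′ →
                    IrreflexiveRel (λ a b → if s a b then R a b else R′ a b)
ifThenElse-irrefl {s = s} irrefl irrefl′ a with s a a
... | true  = irrefl a
... | false = irrefl′ a

-- Tripartite graphs of matrices

Matrix : ℕ → Set
Matrix k = Fin k → Fin k → Bool

data Side (k : ℕ) : Set where
  U V W : Fin k → Side k

module _ {k : ℕ} where

  tripartite : Matrix k → Side k → Side k → Bool
  tripartite M (U i)  (V j)  = M i j
  tripartite M (V j)  (U i)  = M i j
  tripartite M (U i)  (W j)  = not (M i j)
  tripartite M (W j)  (U i)  = not (M i j)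
  tripartite M (V j)  (W j′) = ⌊ j ≟ᶠ j′ ⌋
  tripartite M (W j′) (V j)  = ⌊ j ≟ᶠ j′ ⌋
  tripartite M _      _      = false

  tripartite-sym : ∀ M → SymmetricRel (tripartite M)
  tripartite-sym M (U _) (V _) t = t
  tripartite-sym M (U _) (W _) t = t
  tripartite-sym M (V _) (U _) t = t
  tripartite-sym M (V _) (W _) t = t
  tripartite-sym M (W _) (U _) t = t
  tripartite-sym M (W _) (V _) t = t
  tripartite-sym M (U _) (U _) ()
  tripartite-sym M (V _) (V _) ()
  tripartite-sym M (W _) (W _) ()

  tripartite-irrefl : ∀ M → IrreflexiveRel (tripartite M)
  tripartite-irrefl M (U _) ()
  tripartite-irrefl M (V _) ()
  tripartite-irrefl M (W _) ()

  private
    UVW-inconsistent : (M : Matrix k) {i j j′ : Fin k} → T (M i j) → T (not (M i j′)) → T (⌊ j ≟ᶠ j′ ⌋) → ⊥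
    UVW-inconsistent M {i} {j} {j′} ij ij′ jj′ with j ≟ᶠ j′
    ... | no  _    = jj′
    ... | yes refl = notBoth (M i j) ij ij′
      where
      notBoth : ∀ b → T b → T (not b) → ⊥
      notBoth true _ ()

  -- The only triangles of the underlying complete tripartite graph are U_i V_j W_j′.
  tripartite-triangleFree : ∀ M → TriangleFree (tripartite M)
  tripartite-triangleFree M (U i)  (V j)  (W j′) ij ij′ jj′ = UVW-inconsistent M {i} {j} {j′} ij ij′ jj′
  tripartite-triangleFree M (U i)  (W j′) (V j)  ij′ ij jj′ = UVW-inconsistent M {i} {j} {j′} ij ij′ jj′
  tripartite-triangleFree M (V j)  (U i)  (W j′) ij jj′ ij′ = UVW-inconsistent M {i} {j} {j′} ij ij′ jj′
  tripartite-triangleFree M (V j)  (W j′) (U i)  jj′ ij ij′ = UVW-inconsistent M {i} {j} {j′} ij ij′ jj′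
  tripartite-triangleFree M (W j′) (U i)  (V j)  ij′ jj′ ij = UVW-inconsistent M {i} {j} {j′} ij ij′ jj′
  tripartite-triangleFree M (W j′) (V j)  (U i)  jj′ ij′ ij = UVW-inconsistent M {i} {j} {j′} ij ij′ jj′
  tripartite-triangleFree M (U _) (U _) _ ()
  tripartite-triangleFree M (V _) (V _) _ ()
  tripartite-triangleFree M (W _) (W _) _ ()
  tripartite-triangleFree M (U _) (V _) (U _) _ ()
  tripartite-triangleFree M (U _) (V _) (V _) _ _ ()
  tripartite-triangleFree M (U _) (W _) (U _) _ ()
  tripartite-triangleFree M (U _) (W _) (W _) _ _ ()
  tripartite-triangleFree M (V _) (U _) (U _) _ _ ()
  tripartite-triangleFree M (V _) (U _) (V _) _ ()
  tripartite-triangleFree M (V _) (W _) (V _) _ ()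
  tripartite-triangleFree M (V _) (W _) (W _) _ _ ()
  tripartite-triangleFree M (W _) (U _) (U _) _ _ ()
  tripartite-triangleFree M (W _) (U _) (W _) _ ()
  tripartite-triangleFree M (W _) (V _) (V _) _ _ ()
  tripartite-triangleFree M (W _) (V _) (W _) _ ()

  rowColumn : Maybe (Side k) → Maybe (Side k) → Bool
  rowColumn (just (U _)) (just (V _)) = true
  rowColumn (just (V _)) (just (U _)) = true
  rowColumn _            _            = false

module _ {A : Set} {P : A → Set} (P? : Decidable P) (P-irrelevant : Irrelevant P) where

  witnessed : List A → List (Σ A P)
  witnessed []       = []
  witnessed (x ∷ xs) with P? x
  ... | yes px = (x , px) ∷ witnessed xs
  ... | no  _  = witnessed xs

  ∈-witnessed⁻ : ∀ {y} xs → y ∈ witnessed xs → proj₁ y ∈ xs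
  ∈-witnessed⁻ (x ∷ xs) y∈ with P? x
  ∈-witnessed⁻ (x ∷ xs) (here refl) | yes _ = here refl
  ∈-witnessed⁻ (x ∷ xs) (there y∈)  | yes _ = there (∈-witnessed⁻ xs y∈)
  ∈-witnessed⁻ (x ∷ xs) y∈          | no  _ = there (∈-witnessed⁻ xs y∈)

  ∈-witnessed⁺ : ∀ {x} xs (px : P x) → x ∈ xs → (x , px) ∈ witnessed xs
  ∈-witnessed⁺ (y ∷ xs) px x∈ with P? y
  ∈-witnessed⁺ (y ∷ xs) px (here refl) | yes py rewrite P-irrelevant px py = here refl
  ∈-witnessed⁺ (y ∷ xs) px (there x∈)  | yes _  = there (∈-witnessed⁺ xs px x∈)
  ∈-witnessed⁺ (y ∷ xs) px (here refl) | no ¬py = contradiction px ¬py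
  ∈-witnessed⁺ (y ∷ xs) px (there x∈)  | no _   = ∈-witnessed⁺ xs px x∈

  witnessed-unique : ∀ {xs} → Unique xs → Unique (witnessed xs)
  witnessed-unique {[]}     _ = []
  witnessed-unique {x ∷ xs} (x∉xs ∷ distinct) with P? x
  ... | yes _ = All.tabulate (λ y∈ x≡y → All.lookup x∉xs (∈-witnessed⁻ xs y∈) (cong proj₁ x≡y))
                  ∷ witnessed-unique distinct
  ... | no  _ = witnessed-unique distinct

module _ {n : ℕ} where

  allEdges : List (Edge n)
  allEdges = witnessed (λ p → proj₁ p <ᶠ? proj₂ p) <-irrelevant (cartesianProduct (allFin n) (allFin n))

  allEdges-unique : Unique allEdges
  allEdges-unique = witnessed-unique _ <-irrelevant (cartesianProduct⁺ (allFin⁺ n) (allFin⁺ n))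

  ∈-allEdges : ∀ e → e ∈ allEdges
  ∈-allEdges ((u , v) , u<v) =
    ∈-witnessed⁺ _ <-irrelevant _ u<v (∈-cartesianProduct⁺ (∈-allFin u) (∈-allFin v))

  edgesWhere : (Edge n → Bool) → List (Edge n)
  edgesWhere p = filterᵇ p allEdges

  edgesWhere-cong : ∀ {p q} → (∀ e → p e ≡ q e) → edgesWhere p ≡ edgesWhere q
  edgesWhere-cong p≗q = filter-≐ _ _ ((λ {e} → subst T (p≗q e)) , (λ {e} → subst T (sym (p≗q e)))) allEdges

  ∈-edgesWhere⁻ : ∀ p {e} → e ∈ edgesWhere p → T (p e)
  ∈-edgesWhere⁻ p e∈ = proj₂ (∈-filter⁻ (T? ∘ p) {xs = allEdges} e∈)

  ∈-edgesWhere⁺ : ∀ p {e} → T (p e) → e ∈ edgesWhere p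
  ∈-edgesWhere⁺ p = ∈-filter⁺ (T? ∘ p) (∈-allEdges _)

  selected unselected : (Edge n → Bool) → Graph n → List (Edge n)
  selected   s G = edgesWhere (λ e → s e ∧ G e)
  unselected s G = edgesWhere (λ e → not (s e) ∧ G e)

  selected++unselected-isEdgeOrder : ∀ s G → IsEdgeOrder G (selected s G ++ unselected s G)
  selected++unselected-isEdgeOrder s G =
    ++⁺ (filter⁺ _ allEdges-unique) (filter⁺ _ allEdges-unique) disjoint , λ e → edgeOf e , streamed e
    where
    disjoint : ∀ {e} → ¬ (e ∈ selected s G × e ∈ unselected s G)
    disjoint {e} (e∈ , e∈′) with s e | ∈-edgesWhere⁻ _ e∈ | ∈-edgesWhere⁻ _ e∈′
    ... | true  | _  | ()
    ... | false | () | _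
    edgeOf : ∀ e → e ∈ selected s G ++ unselected s G → G e ≡ true
    edgeOf e e∈ with ∈-++⁻ (selected s G) e∈
    ... | inj₁ e∈s = Equivalence.to T-≡ (proj₂ (Equivalence.to T-∧ (∈-edgesWhere⁻ _ e∈s)))
    ... | inj₂ e∈u = Equivalence.to T-≡ (proj₂ (Equivalence.to T-∧ (∈-edgesWhere⁻ _ e∈u)))
    streamed : ∀ e → G e ≡ true → e ∈ selected s G ++ unselected s G
    streamed e Ge with s e in se
    ... | true  = ∈-++⁺ˡ (∈-edgesWhere⁺ _ (Equivalence.from T-∧ (subst T (sym se) _ , Equivalence.from T-≡ Ge)))
    ... | false = ∈-++⁺ʳ (selected s G) (∈-edgesWhere⁺ _ (Equivalence.from T-∧ (subst (T ∘ not) (sym se) _ , Equivalence.from T-≡ Ge)))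

  splice : (Edge n → Bool) → Graph n → Graph n → Graph n
  splice s G G′ e = if s e then G e else G′ e

  selected-splice : ∀ s G G′ → selected s (splice s G G′) ≡ selected s G
  selected-splice s G G′ = edgesWhere-cong agree
    where
    agree : ∀ e → s e ∧ splice s G G′ e ≡ s e ∧ G e
    agree e with s e
    ... | true  = refl
    ... | false = refl

  unselected-splice : ∀ s G G′ → unselected s (splice s G G′) ≡ unselected s G′
  unselected-splice s G G′ = edgesWhere-cong agree
    where
    agree : ∀ e → not (s e) ∧ splice s G G′ e ≡ not (s e) ∧ G′ e
    agree e with s e
    ... | true  = refl
    ... | false = refl

module _ {n c m : ℕ} (S : Scheme n c m) where
  open Scheme S

  stateAfter : Cert → List (Edge n) → Vec Bool m
  stateAfter w = foldl (step w) (init w)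

  stateAfter-separates : ∀ {P G H xs xs′ ys} → Correct P S →
                         P G → IsEdgeOrder G (xs ++ ys) → ¬ P H → IsEdgeOrder H (xs′ ++ ys) →
                         stateAfter (prover G) xs′ ≢ stateAfter (prover G) xs
  stateAfter-separates {G = G} {H} {xs} {xs′} {ys} (complete , sound) PG orderG ¬PH orderH same =
    true≢false (begin
      true                                ≡⟨ complete G PG _ orderG ⟨
      run w (xs ++ ys)                    ≡⟨ cong (out w) (foldl-++ (step w) (init w) xs ys) ⟩
      out w (foldl (step w) (stateAfter w xs) ys)  ≡⟨ cong (λ σ → out w (foldl (step w) σ ys)) same ⟨
      out w (foldl (step w) (stateAfter w xs′) ys) ≡⟨ cong (out w) (foldl-++ (step w) (init w) xs′ ys) ⟨
      run w (xs′ ++ ys)                   ≡⟨ sound H ¬PH w _ orderH ⟩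
      false                               ∎)
    where
    open ≡-Reasoning
    w = prover G
    true≢false : true ≢ false
    true≢false ()

module _ where
  open Inverse 2↔Bool using (to; from; strictlyInverseˡ; strictlyInverseʳ)

  bitsToFin : ∀ {a} → Vec Bool a → Fin (2 ^ a)
  bitsToFin []      = zero
  bitsToFin (b ∷ v) = combine (from b) (bitsToFin v)

  finToBits : ∀ a → Fin (2 ^ a) → Vec Bool a
  finToBits zero    _ = []
  finToBits (suc a) i = to (proj₁ (remQuot {2} (2 ^ a) i)) ∷ finToBits a (proj₂ (remQuot {2} (2 ^ a) i))

  finToBits-bitsToFin : ∀ {a} (v : Vec Bool a) → finToBits a (bitsToFin v) ≡ v
  finToBits-bitsToFin []               = refl
  finToBits-bitsToFin {suc a} (b ∷ v) =
    trans (cong (λ (bit , i) → to bit ∷ finToBits a i) (remQuot-combine {2} {2 ^ a} (from b) (bitsToFin v)))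
          (cong₂ _∷_ (strictlyInverseˡ b) (finToBits-bitsToFin v))

  bitsToFin-finToBits : ∀ a (i : Fin (2 ^ a)) → bitsToFin (finToBits a i) ≡ i
  bitsToFin-finToBits zero    zero = refl
  bitsToFin-finToBits (suc a) i =
    trans (cong₂ combine (strictlyInverseʳ (proj₁ (remQuot {2} (2 ^ a) i))) (bitsToFin-finToBits a (proj₂ (remQuot {2} (2 ^ a) i))))
          (combine-remQuot {2} (2 ^ a) i)

  bits-injection⇒≤ : ∀ {a b} (f : Vec Bool a → Vec Bool b) → Injective _≡_ _≡_ f → a ≤ b
  bits-injection⇒≤ {a} {b} f f-injective =
    ℕ.≮⇒≥ λ b<a → ℕ.<⇒≱ (ℕ.^-monoʳ-< 2 (s≤s (s≤s z≤n)) b<a) (injective⇒≤ {f = g} g-injective)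
    where
    g : Fin (2 ^ a) → Fin (2 ^ b)
    g = bitsToFin ∘ f ∘ finToBits a
    g-injective : Injective _≡_ _≡_ g
    g-injective {i} {j} gi≡gj = begin
      i                            ≡⟨ bitsToFin-finToBits a i ⟨
      bitsToFin (finToBits a i)    ≡⟨ cong bitsToFin (f-injective (begin
        f (finToBits a i)                         ≡⟨ finToBits-bitsToFin _ ⟨
        finToBits b (g i)                         ≡⟨ cong (finToBits b) gi≡gj ⟩
        finToBits b (g j)                         ≡⟨ finToBits-bitsToFin _ ⟩
        f (finToBits a j)                         ∎)) ⟩
      bitsToFin (finToBits a j)    ≡⟨ bitsToFin-finToBits a j ⟩
      j                            ∎
      where open ≡-Reasoning

-- The marker bit true after w makes padding injective.
pad : ∀ c (w : List Bool) → length w ≤ c → Vec Bool (suc c)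
pad c       []      _       = true ∷ replicate c false
pad (suc c) (b ∷ w) (s≤s p) = b ∷ pad c w p

pad≢replicate : ∀ c w p → pad c w p ≢ replicate (suc c) false
pad≢replicate c       []      _       ()
pad≢replicate (suc c) (b ∷ w) (s≤s p) eq = pad≢replicate c w p (∷-injective eq .proj₂)

pad-injective : ∀ c w w′ p p′ → pad c w p ≡ pad c w′ p′ → w ≡ w′
pad-injective c       []      []        _       _        _  = refl
pad-injective (suc c) []      (_ ∷ w′)  _       (s≤s p′) eq = ⊥-elim (pad≢replicate c w′ p′ (sym (∷-injective eq .proj₂)))
pad-injective (suc c) (_ ∷ w) []        (s≤s p) _        eq = ⊥-elim (pad≢replicate c w p (∷-injective eq .proj₂))
pad-injective (suc c) (b ∷ w) (b′ ∷ w′) (s≤s p) (s≤s p′) eq =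
  cong₂ _∷_ (∷-injective eq .proj₁) (pad-injective c w w′ p p′ (∷-injective eq .proj₂))

Bools-agree : ∀ {a b} → (T a → T (not b) → ⊥) → (T b → T (not a) → ⊥) → a ≡ b
Bools-agree {true}  {true}  _ _ = refl
Bools-agree {false} {false} _ _ = refl
Bools-agree {true}  {false} a¬b _ = ⊥-elim (a¬b _ _)
Bools-agree {false} {true}  _ b¬a = ⊥-elim (b¬a _ _)

-- The fooling family

module _ (k r : ℕ) where

  order : ℕ
  order = suc (k + (k + (k + r)))

  Vertex : Set
  Vertex = Fin order

  -- Vertex 0 and the r spare vertices are all apexes; apexes are pairwise non-adjacent.
  label : Vertex → Maybe (Side k)
  label zero    = nothing
  label (suc v) =
    [ just ∘ U , [ just ∘ V , [ just ∘ W , (λ _ → nothing) ]′ ∘ splitAt k ]′ ∘ splitAt k ]′ (splitAt k v)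

  uVertex vVertex wVertex : Fin k → Vertex
  uVertex i = suc (i ↑ˡ (k + (k + r)))
  vVertex j = suc (k ↑ʳ (j ↑ˡ (k + r)))
  wVertex j = suc (k ↑ʳ (k ↑ʳ (j ↑ˡ r)))

  label-uVertex : ∀ i → label (uVertex i) ≡ just (U i)
  label-uVertex i rewrite splitAt-↑ˡ k i (k + (k + r)) = refl

  label-vVertex : ∀ j → label (vVertex j) ≡ just (V j)
  label-vVertex j rewrite splitAt-↑ʳ k (k + (k + r)) (j ↑ˡ (k + r)) | splitAt-↑ˡ k j (k + r) = refl

  label-wVertex : ∀ j → label (wVertex j) ≡ just (W j)
  label-wVertex j
    rewrite splitAt-↑ʳ k (k + (k + r)) (k ↑ʳ (j ↑ˡ r)) | splitAt-↑ʳ k (k + r) (j ↑ˡ r) | splitAt-↑ˡ k j r = refl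

  coneGraph : Matrix k → Graph order
  coneGraph M = labelGraph (cone (tripartite M)) label

  coneGraph-MaxClique≤3 : ∀ M → MaxClique≤3 (coneGraph M)
  coneGraph-MaxClique≤3 M =
    labelGraph-MaxClique≤3 {ℓ = label} (cone-sym {R = tripartite M} (tripartite-sym M))
                                         (cone-K4-free {R = tripartite M} (tripartite-triangleFree M))

  rowColumnEdge : Edge order → Bool
  rowColumnEdge = labelGraph rowColumn label

  splice-K4 : ∀ M M′ {i j} → T (M i j) → T (not (M′ i j)) →
              ¬ MaxClique≤3 (splice rowColumnEdge (coneGraph M) (coneGraph M′))
  splice-K4 M M′ {i} {j} ij ¬ij = K4⇒¬MaxClique≤3 {G = labelGraph hybrid label}
    {zero} {uVertex i} {vVertex j} {wVertex j}
    ((edge refl (label-uVertex i) _ _ ∷ edge refl (label-vVertex j) _ _ ∷ edge refl (label-wVertex j) _ _ ∷ [])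
    ∷ (edge (label-uVertex i) (label-vVertex j) ij ij ∷ edge (label-uVertex i) (label-wVertex j) ¬ij ¬ij ∷ [])
    ∷ (edge (label-vVertex j) (label-wVertex j) jj jj ∷ [])
    ∷ [] ∷ [])
    where
    hybrid : Maybe (Side k) → Maybe (Side k) → Bool
    hybrid a b = if rowColumn a b then cone (tripartite M) a b else cone (tripartite M′) a b
    jj : T ⌊ j ≟ᶠ j ⌋
    jj = fromWitness {a? = j ≟ᶠ j} refl
    edge : ∀ {u v a b} → label u ≡ a → label v ≡ b → T (hybrid a b) → T (hybrid b a) →
           Adj (labelGraph hybrid label) u v
    edge refl refl = Related⇒Adj {R = hybrid} {ℓ = label}
      (ifThenElse-irrefl {s = rowColumn} {cone (tripartite M)} {cone (tripartite M′)}
        (cone-irrefl {R = tripartite M} (tripartite-irrefl M))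
        (cone-irrefl {R = tripartite M′} (tripartite-irrefl M′)))

  module _ {c m : ℕ} (S : Scheme order c m) (correct : Correct MaxClique≤3 S) where
    open Scheme S using (prover; proverLen)

    entry : Vec Bool (k * k) → Matrix k
    entry x i j = lookup x (combine i j)

    graphOf : Vec Bool (k * k) → Graph order
    graphOf x = coneGraph (entry x)

    configuration : Vec Bool (k * k) → Vec Bool (suc c + m)
    configuration x = pad c (prover (graphOf x)) (proverLen (graphOf x))
                      Vec.++ stateAfter S (prover (graphOf x)) (selected rowColumnEdge (graphOf x))

    configuration-separates : ∀ x y {i j} → T (entry x i j) → T (not (entry y i j)) →
                              configuration x ≢ configuration y
    configuration-separates x y ij ¬ij same =
      stateAfter-separates S {xs = selected rowColumnEdge (graphOf y)}
        {xs′ = selected rowColumnEdge (graphOf x)} {ys = unselected rowColumnEdge (graphOf y)}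
        correct (coneGraph-MaxClique≤3 (entry y))
        (selected++unselected-isEdgeOrder rowColumnEdge (graphOf y))
        (splice-K4 (entry x) (entry y) ij ¬ij)
        (subst₂ (λ xs ys → IsEdgeOrder hybrid (xs ++ ys))
          (selected-splice rowColumnEdge (graphOf x) (graphOf y))
          (unselected-splice rowColumnEdge (graphOf x) (graphOf y))
          (selected++unselected-isEdgeOrder rowColumnEdge hybrid))
        (trans (cong (λ w → stateAfter S w (selected rowColumnEdge (graphOf x))) (sym same-certificate))
               same-state)
      where
      hybrid = splice rowColumnEdge (graphOf x) (graphOf y)
      same-certificate : prover (graphOf x) ≡ prover (graphOf y)
      same-certificate = pad-injective c _ _ _ _ (++-injective _ _ same .proj₁)
      same-state = ++-injective _ _ same .proj₂

    configuration-injective : Injective _≡_ _≡_ configuration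
    configuration-injective {x} {y} same = begin
      x                  ≡⟨ tabulate∘lookup x ⟨
      tabulate (lookup x) ≡⟨ tabulate-cong entries-agree ⟩
      tabulate (lookup y) ≡⟨ tabulate∘lookup y ⟩
      y                  ∎
      where
      open ≡-Reasoning
      entries-agree : ∀ t → lookup x t ≡ lookup y t
      entries-agree t = subst (λ t → lookup x t ≡ lookup y t) (combine-remQuot {k} k t)
        (Bools-agree (λ xt ¬yt → configuration-separates x y xt ¬yt same)
                     (λ yt ¬xt → configuration-separates y x yt ¬xt (sym same)))

    lowerBound : k * k ≤ suc (c + m)
    lowerBound = bits-injection⇒≤ configuration configuration-injective

thirds : ∀ t → ∃₂ λ q r → r ≤ 2 × t ≡ q + (q + (q + r))
thirds t = t / 3 , t % 3 , s≤s⁻¹ (m%n<n t 3) , trans (m≡m%n+[m/n]*n t 3) (regroup (t % 3) (t / 3))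
  where
  regroup : ∀ r q → r + q * 3 ≡ q + (q + (q + r))
  regroup = solve-∀

square-bound : ∀ {q r s} → r ≤ 2 → 7 ≤ suc (q + (q + (q + r))) → q * q ≤ suc s →
               suc (q + (q + (q + r))) * suc (q + (q + (q + r))) ≤ 72 * s
square-bound {zero}        r≤2 7≤n _ = contradiction (ℕ.≤-trans 7≤n (s≤s r≤2)) (from-no (7 ℕ.≤? 3))
square-bound {suc zero}    r≤2 7≤n _ = contradiction (ℕ.≤-trans 7≤n (s≤s (s≤s (s≤s (s≤s r≤2))))) (from-no (7 ℕ.≤? 6))
square-bound {q@(suc (suc q′))} {r} {s} r≤2 _ qq≤1+s = begin
  n * n                 ≤⟨ ℕ.*-mono-≤ n≤6q n≤6q ⟩
  (6 * q) * (6 * q)     ≡⟨ six-squared q ⟩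
  36 * (q * q)          ≤⟨ ℕ.*-monoʳ-≤ 36 qq≤1+s ⟩
  36 * suc s            ≤⟨ ℕ.*-monoʳ-≤ 36 1+s≤2s ⟩
  36 * (2 * s)          ≡⟨ ℕ.*-assoc 36 2 s ⟨
  72 * s                ∎
  where
  open ℕ.≤-Reasoning
  n = suc (q + (q + (q + r)))
  six-squared : ∀ q → (6 * q) * (6 * q) ≡ 36 * (q * q)
  six-squared = solve-∀
  regroup : ∀ q r → suc (q + (q + (q + r))) ≡ suc r + 3 * q
  regroup = solve-∀
  n≤6q : n ≤ 6 * q
  n≤6q = begin
    n                ≡⟨ regroup q r ⟩
    suc r + 3 * q    ≤⟨ ℕ.+-monoˡ-≤ (3 * q) (s≤s r≤2) ⟩
    3 + 3 * q        ≤⟨ ℕ.+-monoˡ-≤ (3 * q) (ℕ.m≤m*n 3 q) ⟩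
    3 * q + 3 * q    ≡⟨ ℕ.*-distribʳ-+ q 3 3 ⟨
    6 * q            ∎
  1≤s : 1 ≤ s
  1≤s = ℕ.≤-trans (s≤s z≤n) (s≤s⁻¹ qq≤1+s)
  1+s≤2s : suc s ≤ 2 * s
  1+s≤2s = begin
    1 + s          ≤⟨ ℕ.+-monoˡ-≤ s 1≤s ⟩
    s + s          ≡⟨ cong (s +_) (ℕ.+-identityʳ s) ⟨
    2 * s          ∎

theorem20 : (c m : ℕ → ℕ) (S : (n : ℕ) → Scheme n (c n) (m n))
    → ((n : ℕ) → Correct MaxClique≤3 (S n))
    → Σ ℕ (λ k → Σ ℕ (λ N → ∀ n → N ≤ n → n * n ≤ k * (c n + m n)))
theorem20 c m S correct = 72 , 7 , bound
  where
  bound : ∀ n → 7 ≤ n → n * n ≤ 72 * (c n + m n)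
  bound (suc t) 7≤n with thirds t
  ... | q , r , r≤2 , refl = square-bound {q} r≤2 7≤n (lowerBound q r (S _) (correct _))
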